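{- Let $G$ be a finite graph and $v_0\in V(G)$. Then there exists an independent set $A_0$ of $G$ with $v_0\in A_0$ such that for every fractional coloring $(x_A)_{A\in S(G)}$ of $G$ there is a vertex $v\in A_0$ with $$\sum_{A\in S(G):\ N(v)\cap A\neq\emptyset} x_A\ \ge\ \chi^*(G)-1.$$
   Context: $S(G)$ denotes the set of independent sets of $G$ and $N(v)$ the set of neighbors of $v$. A fractional coloring of $G$ is a family of reals $(x_A)_{A\in S(G)}$ with $x_A\ge 0$ for all $A$ and $\sum_{A\in S(G):\,v\in A}x_A\ge 1$ for every vertex $v$. The fractional chromatic number $\chi^*(G)$ is the minimum of $\sum_{A\in S(G)}x_A$ over all fractional colorings of $G$.
   Formalization: The fractional colorings $(x_A)_{A\in S(G)}$ have rational weights rather than real ones, and $\chi^*(G)$ is the minimum total weight over rational fractional colorings. -}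

module Defs where

open import Data.Nat using (ℕ; zero; suc)
open import Data.Bool using (Bool; true; false; _∧_; _∨_; not; T; if_then_else_)
open import Data.Fin using (Fin)
open import Data.Vec using (Vec; []; _∷_; lookup)
open import Data.List using (List; []; _∷_; [_]; map; _++_; foldr; filterᵇ)
open import Data.Bool.ListAction using (all; any)
open import Data.List using () renaming (allFin to allFinL)
open import Data.Fin.Subset using (Subset)
open import Data.Rational using (ℚ; 0ℚ; 1ℚ; _+_; _≤_)
open import Data.Product using (_×_)
open import Relation.Binary.PropositionalEquality using (_≡_)

record Graph (n : ℕ) : Set where
  field
    adj    : Fin n → Fin n → Bool
    sym    : ∀ u v → adj u v ≡ adj v u
    irrefl : ∀ v → adj v v ≡ false
open Graph public

allSubsets : (n : ℕ) → List (Subset n)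
allSubsets zero    = [ [] ]
allSubsets (suc n) = map (true ∷_) (allSubsets n) ++ map (false ∷_) (allSubsets n)

independentᵇ : ∀ {n} → Graph n → Subset n → Bool
independentᵇ {n} G A =
  all (λ u → all (λ v → not (lookup A u ∧ lookup A v ∧ adj G u v)) (allFinL n)) (allFinL n)

Independent : ∀ {n} → Graph n → Subset n → Set
Independent G A = T (independentᵇ G A)

S : ∀ {n} → Graph n → List (Subset n)
S G = filterᵇ (independentᵇ G) (allSubsets _)

meetsNbhdᵇ : ∀ {n} → Graph n → Fin n → Subset n → Bool
meetsNbhdᵇ {n} G v A = any (λ u → adj G v u ∧ lookup A u) (allFinL n)

sumWhere : ∀ {n} → List (Subset n) → (Subset n → Bool) → (Subset n → ℚ) → ℚ
sumWhere L p x = foldr (λ A acc → (if p A then x A else 0ℚ) + acc) 0ℚ L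

-- Weights x_A for A ∈ S(G) (values on non-independent sets are ignored).
Weights : ℕ → Set
Weights n = Subset n → ℚ

totalWeight : ∀ {n} → Graph n → Weights n → ℚ
totalWeight G x = sumWhere (S G) (λ _ → true) x

FractionalColoring : ∀ {n} → Graph n → Weights n → Set
FractionalColoring {n} G x =
  (∀ A → Independent G A → 0ℚ ≤ x A) ×
  (∀ (v : Fin n) → 1ℚ ≤ sumWhere (S G) (λ A → lookup A v) x)

data IsFracChromaticNumber {n} (G : Graph n) (q : ℚ) : Set where
  isFCN : (x : Weights n) → FractionalColoring G x → totalWeight G x ≡ q →
          (∀ y → FractionalColoring G y → q ≤ totalWeight G y) →
          IsFracChromaticNumber G q

module Submission where

-- Take an optimal fractional colouring x₀ (of weight χ) and an independent set A₀ ∋ v₀ with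
-- a = x₀(A₀) > 0.  Given a fractional colouring x of weight W, let w ∈ A₀ maximise the weight t
-- of the independent sets meeting N(w).  If t ≥ W - 1 we are done, as W ≥ χ.  Otherwise enlarge
-- every independent set A to A ∪ {u ∈ A₀ : N(u) ∩ A = ∅}; pushed through this map, x covers each
-- v ∈ A₀ with weight W - t or more.  For s = W - 1 - t ≥ 0 the weighting
-- s·x₀ - s·a·[A₀] + a·(pushed x) is nonnegative, covers every vertex at least s + a and has
-- weight sχ - sa + aW, so minimality of χ gives χ(s + a) ≤ sχ - sa + aW, i.e. χ - 1 ≤ t.

open import Defs hiding (sym)
open import Data.Bool using (Bool; true; false; _≟_; _∧_; _∨_; not; T; if_then_else_)
open import Data.Bool.ListAction using (all)
open import Data.Bool.Properties using (T-≡; T-∨; T-∧; if-swap-then)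
open import Data.Empty using (⊥-elim)
open import Data.Fin using (Fin)
open import Data.Fin.Subset using (Subset; _∈_)
open import Data.List using (List; []; _∷_; map; _++_; foldr; filterᵇ) renaming (allFin to allFinL)
open import Data.List.Membership.Propositional using (lose) renaming (_∈_ to _∈ₗ_)
open import Data.List.Membership.Propositional.Properties using (∈-filter⁺; ∈-filter⁻; ∈-allFin)
open import Data.List.Relation.Unary.All as All using ()
open import Data.List.Relation.Unary.All.Properties using (all⁺; all⁻; all-filter)
open import Data.List.Relation.Unary.Any using (here; there; satisfied)
open import Data.List.Relation.Unary.Any.Properties using (any⁺; any⁻)
open import Data.Nat using (ℕ; suc)
open import Data.Product using (Σ; _×_; ∃-syntax; _,_; proj₁; proj₂)
open import Data.Rational
  using (ℚ; 0ℚ; 1ℚ; _+_; _-_; _*_; -_; _≤_; _<_; 1/_; NonZero; Positive; NonNegative; positive; nonNegative)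
import Data.Rational.Properties as ℚ
open import Data.Rational.Solver using (module +-*-Solver)
open import Data.Sum using (_⊎_; inj₁; inj₂)
open import Data.Vec using ([]; _∷_; lookup; tabulate)
open import Data.Vec.Properties using (≡-dec; lookup∘tabulate; lookup⇒[]=)
open import Function using (_∘_; Equivalence)
open import Relation.Binary.Bundles using (DecTotalOrder)
open import Relation.Binary.Definitions using (DecidableEquality)
open import Relation.Binary.PropositionalEquality
  using (_≡_; refl; sym; trans; cong; cong₂; subst; subst₂; module ≡-Reasoning)
open import Relation.Nullary using (yes; no; ¬_)
open import Relation.Nullary.Decidable using (does; T?)

open import Data.List.Extrema (DecTotalOrder.totalOrder ℚ.≤-decTotalOrder)
  using (argmax; argmax-all; f[xs]≤f[argmax])

open +-*-Solver
open Equivalence using (to; from)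

p≤q⇒0≤q-p : ∀ {p q} → p ≤ q → 0ℚ ≤ q - p
p≤q⇒0≤q-p {p} {q} p≤q = subst (_≤ q - p) (ℚ.+-inverseʳ p) (ℚ.+-monoˡ-≤ (- p) p≤q)

0≤q-p⇒p≤q : ∀ {p q} → 0ℚ ≤ q - p → p ≤ q
0≤q-p⇒p≤q {p} {q} 0≤q-p = subst₂ _≤_ (ℚ.+-identityˡ p)
  (solve 2 (λ p q → (q :- p) :+ p := q) refl p q) (ℚ.+-monoˡ-≤ p 0≤q-p)

*-nonNeg : ∀ {p q} → 0ℚ ≤ p → 0ℚ ≤ q → 0ℚ ≤ p * q
*-nonNeg {p} {q} 0≤p 0≤q = ℚ.nonNegative⁻¹ (p * q)
  {{ℚ.nonNeg*nonNeg⇒nonNeg p {{nonNegative 0≤p}} q {{nonNegative 0≤q}}}}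

T-not-∧∧⁺ : ∀ {a b c} → (T a → T b → ¬ T c) → T (not (a ∧ b ∧ c))
T-not-∧∧⁺ {true}  {true}  {true}  h = h _ _ _
T-not-∧∧⁺ {true}  {true}  {false} h = _
T-not-∧∧⁺ {true}  {false}         h = _
T-not-∧∧⁺ {false}                 h = _

T-not-∧∧⁻ : ∀ {a b c} → T (not (a ∧ b ∧ c)) → T a → T b → ¬ T c
T-not-∧∧⁻ {true} {true} {true} ()

∑ : {X : Set} → List X → (X → ℚ) → ℚ
∑ L f = foldr (λ A acc → f A + acc) 0ℚ L

module _ {X : Set} where

  ∑-cong-∈ : ∀ L {f g : X → ℚ} → (∀ {A} → A ∈ₗ L → f A ≡ g A) → ∑ L f ≡ ∑ L g
  ∑-cong-∈ []      f≡g = refl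
  ∑-cong-∈ (A ∷ L) f≡g = cong₂ _+_ (f≡g (here refl)) (∑-cong-∈ L (f≡g ∘ there))

  ∑-cong : ∀ L {f g : X → ℚ} → (∀ A → f A ≡ g A) → ∑ L f ≡ ∑ L g
  ∑-cong L f≡g = ∑-cong-∈ L (λ {A} _ → f≡g A)

  ∑-zero : ∀ (L : List X) → ∑ L (λ _ → 0ℚ) ≡ 0ℚ
  ∑-zero []      = refl
  ∑-zero (A ∷ L) = trans (ℚ.+-identityˡ _) (∑-zero L)

  ∑-+ : ∀ L (f g : X → ℚ) → ∑ L (λ A → f A + g A) ≡ ∑ L f + ∑ L g
  ∑-+ []      f g = refl
  ∑-+ (A ∷ L) f g = trans (cong (f A + g A +_) (∑-+ L f g))
    (solve 4 (λ p q r s → (p :+ q) :+ (r :+ s) := (p :+ r) :+ (q :+ s)) refl (f A) (g A) (∑ L f) (∑ L g))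

  ∑-*ˡ : ∀ L c (f : X → ℚ) → ∑ L (λ A → c * f A) ≡ c * ∑ L f
  ∑-*ˡ []      c f = sym (ℚ.*-zeroʳ c)
  ∑-*ˡ (A ∷ L) c f = trans (cong (c * f A +_) (∑-*ˡ L c f)) (sym (ℚ.*-distribˡ-+ c (f A) (∑ L f)))

  ∑-mono-∈ : ∀ L {f g : X → ℚ} → (∀ {A} → A ∈ₗ L → f A ≤ g A) → ∑ L f ≤ ∑ L g
  ∑-mono-∈ []      f≤g = ℚ.≤-refl
  ∑-mono-∈ (A ∷ L) f≤g = ℚ.+-mono-≤ (f≤g (here refl)) (∑-mono-∈ L (f≤g ∘ there))

  ∑-nonNeg-∈ : ∀ L {f : X → ℚ} → (∀ {A} → A ∈ₗ L → 0ℚ ≤ f A) → 0ℚ ≤ ∑ L f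
  ∑-nonNeg-∈ L {f} 0≤f = subst (_≤ ∑ L f) (∑-zero L) (∑-mono-∈ L 0≤f)

  ∑-++ : ∀ L M (f : X → ℚ) → ∑ (L ++ M) f ≡ ∑ L f + ∑ M f
  ∑-++ []      M f = sym (ℚ.+-identityˡ _)
  ∑-++ (A ∷ L) M f = trans (cong (f A +_) (∑-++ L M f)) (sym (ℚ.+-assoc (f A) _ _))

  ∑-filterᵇ : ∀ (p : X → Bool) L f → ∑ (filterᵇ p L) f ≡ ∑ L (λ A → if p A then f A else 0ℚ)
  ∑-filterᵇ p []      f = refl
  ∑-filterᵇ p (A ∷ L) f with p A
  ... | true  = cong (f A +_) (∑-filterᵇ p L f)
  ... | false = trans (∑-filterᵇ p L f) (sym (ℚ.+-identityˡ _))

  ∑-if : ∀ b L (f : X → ℚ) → (if b then ∑ L f else 0ℚ) ≡ ∑ L (λ A → if b then f A else 0ℚ)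
  ∑-if true  L f = refl
  ∑-if false L f = sym (∑-zero L)

  ∑-pos : ∀ L (f : X → ℚ) → 0ℚ < ∑ L f → ∃[ A ] A ∈ₗ L × 0ℚ < f A
  ∑-pos []      f 0<0 = ⊥-elim (ℚ.<-irrefl refl 0<0)
  ∑-pos (A ∷ L) f 0<∑ with 0ℚ ℚ.<? f A
  ... | yes 0<fA = A , here refl , 0<fA
  ... | no  0≮fA with ∑-pos L f (ℚ.<-≤-trans 0<∑ fA+∑≤∑)
    where
    fA+∑≤∑ = subst (f A + ∑ L f ≤_) (ℚ.+-identityˡ _) (ℚ.+-monoˡ-≤ (∑ L f) (ℚ.≮⇒≥ 0≮fA))
  ...   | B , B∈L , 0<fB = B , there B∈L , 0<fB

∑-map : ∀ {X Y : Set} (g : Y → X) L (f : X → ℚ) → ∑ (map g L) f ≡ ∑ L (f ∘ g)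
∑-map g []      f = refl
∑-map g (A ∷ L) f = cong (f (g A) +_) (∑-map g L f)

∑-comm : ∀ {X Y : Set} L M (h : X → Y → ℚ) →
  ∑ L (λ A → ∑ M (h A)) ≡ ∑ M (λ B → ∑ L (λ A → h A B))
∑-comm []      M h = sym (∑-zero M)
∑-comm (A ∷ L) M h = trans (cong (∑ M (h A) +_) (∑-comm L M h)) (sym (∑-+ M (h A) _))

module _ {n : ℕ} where

  sumWhere-*ˡ : ∀ L p c (f : Weights n) → sumWhere L p (λ B → c * f B) ≡ c * sumWhere L p f
  sumWhere-*ˡ L p c f = trans (∑-cong L pointwise) (∑-*ˡ L c (λ B → if p B then f B else 0ℚ))
    where
    pointwise : ∀ B → (if p B then c * f B else 0ℚ) ≡ c * (if p B then f B else 0ℚ)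
    pointwise B with p B
    ... | true  = refl
    ... | false = sym (ℚ.*-zeroʳ c)

  sumWhere-linear : ∀ L p c (f g : Weights n) →
    sumWhere L p (λ B → c * f B + g B) ≡ c * sumWhere L p f + sumWhere L p g
  sumWhere-linear L p c f g =
    trans (∑-cong L pointwise)
      (trans (∑-+ L (λ B → if p B then c * f B else 0ℚ) (λ B → if p B then g B else 0ℚ))
        (cong (_+ sumWhere L p g) (sumWhere-*ˡ L p c f)))
    where
    pointwise : ∀ B → (if p B then c * f B + g B else 0ℚ)
                    ≡ (if p B then c * f B else 0ℚ) + (if p B then g B else 0ℚ)
    pointwise B with p B
    ... | true  = refl
    ... | false = sym (ℚ.+-identityˡ 0ℚ)

  sumWhere-nonNeg : ∀ L p {x : Weights n} → (∀ {A} → A ∈ₗ L → 0ℚ ≤ x A) → 0ℚ ≤ sumWhere L p x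
  sumWhere-nonNeg L p {x} 0≤x = ∑-nonNeg-∈ L pointwise
    where
    pointwise : ∀ {A} → A ∈ₗ L → 0ℚ ≤ (if p A then x A else 0ℚ)
    pointwise {A} A∈L with p A
    ... | true  = 0≤x A∈L
    ... | false = ℚ.≤-refl

  sumWhere-mono-pred : ∀ L {p q} {x : Weights n} → (∀ {A} → A ∈ₗ L → 0ℚ ≤ x A) →
    (∀ A → T (p A) → T (q A)) → sumWhere L p x ≤ sumWhere L q x
  sumWhere-mono-pred L {p} {q} {x} 0≤x p⇒q = ∑-mono-∈ L pointwise
    where
    pointwise : ∀ {A} → A ∈ₗ L → (if p A then x A else 0ℚ) ≤ (if q A then x A else 0ℚ)
    pointwise {A} A∈L with p A | q A | p⇒q A
    ... | true  | true  | _   = ℚ.≤-refl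
    ... | true  | false | pq  = ⊥-elim (pq _)
    ... | false | true  | _   = 0≤x A∈L
    ... | false | false | _   = ℚ.≤-refl

  sumWhere-complement : ∀ L {p q} (x : Weights n) → (∀ {A} → A ∈ₗ L → p A ≡ not (q A)) →
    sumWhere L p x + sumWhere L q x ≡ sumWhere L (λ _ → true) x
  sumWhere-complement L {p} {q} x p≡¬q =
    trans (sym (∑-+ L (λ A → if p A then x A else 0ℚ) (λ A → if q A then x A else 0ℚ)))
          (∑-cong-∈ L pointwise)
    where
    pointwise : ∀ {A} → A ∈ₗ L → (if p A then x A else 0ℚ) + (if q A then x A else 0ℚ) ≡ x A
    pointwise {A} A∈L rewrite p≡¬q A∈L with q A
    ... | true  = ℚ.+-identityˡ (x A)
    ... | false = ℚ.+-identityʳ (x A)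

_≟ₛ_ : ∀ {n} → DecidableEquality (Subset n)
_≟ₛ_ = ≡-dec _≟_

pointMass : ∀ {n} → Subset n → Weights n
pointMass C B = if does (B ≟ₛ C) then 1ℚ else 0ℚ

∑-allSubsets-δ : ∀ {n} (C : Subset n) (g : Subset n → ℚ) →
  ∑ (allSubsets n) (λ B → if does (B ≟ₛ C) then g B else 0ℚ) ≡ g C
∑-allSubsets-δ []               g = ℚ.+-identityʳ (g [])
∑-allSubsets-δ {suc n} (b ∷ C) g = begin
    ∑ (map (true ∷_) U ++ map (false ∷_) U) (h b)
  ≡⟨ ∑-++ (map (true ∷_) U) _ (h b) ⟩
    ∑ (map (true ∷_) U) (h b) + ∑ (map (false ∷_) U) (h b)
  ≡⟨ cong₂ _+_ (∑-map _ U (h b)) (∑-map _ U (h b)) ⟩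
    ∑ U (h b ∘ (true ∷_)) + ∑ U (h b ∘ (false ∷_))
  ≡⟨ halves b ⟩
    g (b ∷ C) ∎
  where
  open ≡-Reasoning
  U : List (Subset n)
  U = allSubsets n
  h : Bool → Subset (suc n) → ℚ
  h b′ B = if does (B ≟ₛ (b′ ∷ C)) then g B else 0ℚ
  -- does (≡-dec …) computes on the head bit, so the half with the wrong head is ∑ U (λ _ → 0ℚ).
  halves : ∀ b′ → ∑ U (h b′ ∘ (true ∷_)) + ∑ U (h b′ ∘ (false ∷_)) ≡ g (b′ ∷ C)
  halves true  = trans (cong₂ _+_ (∑-allSubsets-δ C (g ∘ (true ∷_))) (∑-zero U)) (ℚ.+-identityʳ _)
  halves false = trans (cong₂ _+_ (∑-zero U) (∑-allSubsets-δ C (g ∘ (false ∷_)))) (ℚ.+-identityˡ _)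

module _ {n : ℕ} (G : Graph n) where

  private
    nonAdjacentᵇ : Subset n → Fin n → Fin n → Bool
    nonAdjacentᵇ A u v = not (lookup A u ∧ lookup A v ∧ adj G u v)

    nbhdMemberᵇ : Subset n → Fin n → Fin n → Bool
    nbhdMemberᵇ A u w = adj G u w ∧ lookup A w

  independent⁻ : ∀ {A u v} → Independent G A → T (lookup A u) → T (lookup A v) → ¬ T (adj G u v)
  independent⁻ {A} {u} {v} indA =
    T-not-∧∧⁻ (All.lookup (all⁺ (nonAdjacentᵇ A u) (allFinL n) row) (∈-allFin v))
    where
    row = All.lookup (all⁺ (λ u → all (nonAdjacentᵇ A u) (allFinL n)) (allFinL n) indA)
                     (∈-allFin u)

  independent⁺ : ∀ {A} → (∀ {u v} → T (lookup A u) → T (lookup A v) → ¬ T (adj G u v)) →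
    Independent G A
  independent⁺ {A} h =
    all⁻ (λ u → all (nonAdjacentᵇ A u) (allFinL n)) {allFinL n}
         (All.tabulate λ {u} _ →
           all⁻ (nonAdjacentᵇ A u) {allFinL n} (All.tabulate λ _ → T-not-∧∧⁺ h))

  ∈S⇒independent : ∀ {A} → A ∈ₗ S G → Independent G A
  ∈S⇒independent A∈S = proj₂ (∈-filter⁻ (T? ∘ independentᵇ G) {xs = allSubsets n} A∈S)

  meetsNbhd⁺ : ∀ {A u w} → T (adj G u w) → T (lookup A w) → T (meetsNbhdᵇ G u A)
  meetsNbhd⁺ {A} {u} {w} uw Aw = any⁺ (nbhdMemberᵇ A u) (lose (∈-allFin w) (from T-∧ (uw , Aw)))

  meetsNbhd⁻ : ∀ {A u} → T (meetsNbhdᵇ G u A) → ∃[ w ] T (adj G u w) × T (lookup A w)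
  meetsNbhd⁻ {A} {u} meets with satisfied (any⁻ (nbhdMemberᵇ A u) (allFinL n) meets)
  ... | w , uw∧Aw = w , to T-∧ uw∧Aw

  independent⇒¬meetsNbhd : ∀ {A v} → Independent G A → T (lookup A v) → ¬ T (meetsNbhdᵇ G v A)
  independent⇒¬meetsNbhd {A} {v} indA Av meets with meetsNbhd⁻ {A} {v} meets
  ... | w , vw , Aw = independent⁻ {A} indA Av Aw vw


  sumWhere-δ : ∀ {C} → Independent G C → ∀ g → sumWhere (S G) (λ B → does (B ≟ₛ C)) g ≡ g C
  sumWhere-δ {C} indC g = begin
      ∑ (S G) (λ B → if does (B ≟ₛ C) then g B else 0ℚ)
    ≡⟨ ∑-filterᵇ (independentᵇ G) U _ ⟩
      ∑ U (λ B → if independentᵇ G B then (if does (B ≟ₛ C) then g B else 0ℚ) else 0ℚ)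
    ≡⟨ ∑-cong U (λ B → if-swap-then (independentᵇ G B) (does (B ≟ₛ C))) ⟩
      ∑ U (λ B → if does (B ≟ₛ C) then (if independentᵇ G B then g B else 0ℚ) else 0ℚ)
    ≡⟨ ∑-allSubsets-δ C _ ⟩
      (if independentᵇ G C then g C else 0ℚ)
    ≡⟨ cong (if_then g C else 0ℚ) (to T-≡ indC) ⟩
      g C ∎
    where
    open ≡-Reasoning
    U = allSubsets n

  sumWhere-pointMass : ∀ {C} → Independent G C → ∀ q →
    sumWhere (S G) q (pointMass C) ≡ (if q C then 1ℚ else 0ℚ)
  sumWhere-pointMass {C} indC q =
    trans (∑-cong (S G) (λ B → if-swap-then (q B) (does (B ≟ₛ C))))
          (sumWhere-δ indC (λ B → if q B then 1ℚ else 0ℚ))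

  pushforward : (Subset n → Subset n) → Weights n → Weights n
  pushforward f x B = sumWhere (S G) (λ A → does (B ≟ₛ f A)) x

  sumWhere-pushforward : ∀ {f} → (∀ {A} → Independent G A → Independent G (f A)) → ∀ q x →
    sumWhere (S G) q (pushforward f x) ≡ sumWhere (S G) (q ∘ f) x
  sumWhere-pushforward {f} f-ind q x = begin
      ∑ (S G) (λ B → if q B then ∑ (S G) (λ A → (if does (B ≟ₛ f A) then x A else 0ℚ)) else 0ℚ)
    ≡⟨ ∑-cong (S G) (λ B → ∑-if (q B) (S G) (λ A → if does (B ≟ₛ f A) then x A else 0ℚ)) ⟩
      ∑ (S G) (λ B → ∑ (S G) (λ A → if q B then (if does (B ≟ₛ f A) then x A else 0ℚ) else 0ℚ))
    ≡⟨ ∑-comm (S G) (S G)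
         (λ B A → if q B then (if does (B ≟ₛ f A) then x A else 0ℚ) else 0ℚ) ⟩
      ∑ (S G) (λ A → ∑ (S G) (λ B → if q B then (if does (B ≟ₛ f A) then x A else 0ℚ) else 0ℚ))
    ≡⟨ ∑-cong-∈ (S G) (λ {A} A∈S →
         trans (∑-cong (S G) (λ B → if-swap-then (q B) (does (B ≟ₛ f A))))
               (sumWhere-δ (f-ind (∈S⇒independent A∈S)) (λ B → if q B then x A else 0ℚ))) ⟩
      ∑ (S G) (λ A → if q (f A) then x A else 0ℚ) ∎
    where open ≡-Reasoning

  pushforward-nonNeg : ∀ f {x} → (∀ {A} → A ∈ₗ S G → 0ℚ ≤ x A) → ∀ B → 0ℚ ≤ pushforward f x B
  pushforward-nonNeg f 0≤x B = sumWhere-nonNeg (S G) (λ A → does (B ≟ₛ f A)) 0≤x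

  extend : Subset n → Subset n → Subset n
  extend A₀ A = tabulate (λ u → lookup A u ∨ (lookup A₀ u ∧ not (meetsNbhdᵇ G u A)))

  lookup-extend : ∀ A₀ A u →
    lookup (extend A₀ A) u ≡ lookup A u ∨ (lookup A₀ u ∧ not (meetsNbhdᵇ G u A))
  lookup-extend A₀ A = lookup∘tabulate _

  ⊆-extend : ∀ {A₀ A v} → T (lookup A v) → T (lookup (extend A₀ A) v)
  ⊆-extend {A₀} {A} {v} Av = subst T (sym (lookup-extend A₀ A v)) (from T-∨ (inj₁ Av))

  ∈-extend⁻ : ∀ {A₀ A u} → T (lookup (extend A₀ A) u) →
    T (lookup A u) ⊎ (T (lookup A₀ u) × ¬ T (meetsNbhdᵇ G u A))
  ∈-extend⁻ {A₀} {A} {u} u∈ext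
    with lookup A u | lookup A₀ u | meetsNbhdᵇ G u A | subst T (lookup-extend A₀ A u) u∈ext
  ... | true  | _    | _     | _ = inj₁ _
  ... | false | true | false | _ = inj₂ (_ , λ ())

  extend-independent : ∀ {A₀ A} → Independent G A₀ → Independent G A → Independent G (extend A₀ A)
  extend-independent {A₀} {A} indA₀ indA = independent⁺ {extend A₀ A} noEdge
    where
    noEdge : ∀ {u v} → T (lookup (extend A₀ A) u) → T (lookup (extend A₀ A) v) → ¬ T (adj G u v)
    noEdge {u} {v} u∈ext v∈ext uv with ∈-extend⁻ {A₀} {A} u∈ext | ∈-extend⁻ {A₀} {A} v∈ext
    ... | inj₁ Au         | inj₁ Av         = independent⁻ {A} indA Au Av uv
    ... | inj₁ Au         | inj₂ (_ , ¬v~A) = ¬v~A (meetsNbhd⁺ {A} (subst T (Graph.sym G u v) uv) Au)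
    ... | inj₂ (_ , ¬u~A) | inj₁ Av         = ¬u~A (meetsNbhd⁺ {A} uv Av)
    ... | inj₂ (A₀u , _)  | inj₂ (A₀v , _)  = independent⁻ {A₀} indA₀ A₀u A₀v uv

  lookup-extend-∈ : ∀ {A₀ A v} → Independent G A → T (lookup A₀ v) →
    lookup (extend A₀ A) v ≡ not (meetsNbhdᵇ G v A)
  lookup-extend-∈ {A₀} {A} {v} indA A₀v rewrite lookup-extend A₀ A v | to T-≡ A₀v
    with lookup A v in Av | meetsNbhdᵇ G v A in v~A
  ... | false | _     = refl
  ... | true  | false = refl
  ... | true  | true  = ⊥-elim (independent⇒¬meetsNbhd {A} indA (from T-≡ Av) (from T-≡ v~A))

  coverage : Weights n → Fin n → ℚ
  coverage x v = sumWhere (S G) (λ A → lookup A v) x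

  nbhdWeight : Weights n → Fin n → ℚ
  nbhdWeight x v = sumWhere (S G) (meetsNbhdᵇ G v) x

  coverage-≤-extend : ∀ A₀ {x} → (∀ {A} → A ∈ₗ S G → 0ℚ ≤ x A) → ∀ v →
    coverage x v ≤ sumWhere (S G) (λ A → lookup (extend A₀ A) v) x
  coverage-≤-extend A₀ 0≤x v = sumWhere-mono-pred (S G) 0≤x (λ A → ⊆-extend {A₀} {A} {v})

  extend-+-nbhdWeight : ∀ {A₀} x {v} → T (lookup A₀ v) →
    sumWhere (S G) (λ A → lookup (extend A₀ A) v) x + nbhdWeight x v ≡ totalWeight G x
  extend-+-nbhdWeight {A₀} x {v} A₀v = sumWhere-complement (S G) x
    (λ {A} A∈S → lookup-extend-∈ {A₀} {A} {v} (∈S⇒independent A∈S) A₀v)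

  lowerBound-scale : ∀ {χ} → (∀ y → FractionalColoring G y → χ ≤ totalWeight G y) →
    ∀ {y k} → (∀ A → Independent G A → 0ℚ ≤ y A) → 0ℚ < k → (∀ v → k ≤ coverage y v) →
    χ * k ≤ totalWeight G y
  lowerBound-scale {χ} χ-lower {y} {k} 0≤y 0<k k≤cover = begin
      χ * k
    ≤⟨ ℚ.*-monoʳ-≤-nonNeg k (χ-lower y′ (0≤y′ , 1≤cover′)) ⟩
      totalWeight G y′ * k
    ≡⟨ cong (_* k) (sumWhere-*ˡ (S G) (λ _ → true) k⁻¹ y) ⟩
      k⁻¹ * totalWeight G y * k
    ≡⟨ solve 3 (λ i Y k → i :* Y :* k := Y :* (i :* k)) refl k⁻¹ (totalWeight G y) k ⟩
      totalWeight G y * (k⁻¹ * k)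
    ≡⟨ cong (totalWeight G y *_) (ℚ.*-inverseˡ k) ⟩
      totalWeight G y * 1ℚ
    ≡⟨ ℚ.*-identityʳ _ ⟩
      totalWeight G y ∎
    where
    open ℚ.≤-Reasoning
    instance
      k-pos : Positive k
      k-pos = positive 0<k
      k≢0 : NonZero k
      k≢0 = ℚ.pos⇒nonZero k
      k-nonNeg : NonNegative k
      k-nonNeg = ℚ.pos⇒nonNeg k
      k⁻¹-nonNeg : NonNegative (1/ k)
      k⁻¹-nonNeg = ℚ.pos⇒nonNeg (1/ k) {{ℚ.1/pos⇒pos k}}
    k⁻¹ = 1/ k
    y′ : Weights n
    y′ A = k⁻¹ * y A
    0≤y′ : ∀ A → Independent G A → 0ℚ ≤ y′ A
    0≤y′ A indA = *-nonNeg (ℚ.nonNegative⁻¹ k⁻¹) (0≤y A indA)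
    1≤cover′ : ∀ v → 1ℚ ≤ coverage y′ v
    1≤cover′ v = begin
        1ℚ                   ≡⟨ sym (ℚ.*-inverseˡ k) ⟩
        k⁻¹ * k              ≤⟨ ℚ.*-monoˡ-≤-nonNeg k⁻¹ (k≤cover v) ⟩
        k⁻¹ * coverage y v   ≡⟨ sym (sumWhere-*ˡ (S G) (λ A → lookup A v) k⁻¹ y) ⟩
        coverage y′ v        ∎

  module Exchange
    {χ : ℚ} (χ-lower : ∀ y → FractionalColoring G y → χ ≤ totalWeight G y)
    {x₀ : Weights n} (x₀-col : FractionalColoring G x₀) (x₀-total : totalWeight G x₀ ≡ χ)
    {A₀ : Subset n} (indA₀ : Independent G A₀) (0<a : 0ℚ < x₀ A₀)
    {x : Weights n} (x-col : FractionalColoring G x)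
    {t : ℚ} (nbhd≤t : ∀ v → T (lookup A₀ v) → nbhdWeight x v ≤ t)
    (t≤W-1 : t ≤ totalWeight G x - 1ℚ)
    where

    a W s : ℚ
    a = x₀ A₀
    W = totalWeight G x
    s = W - 1ℚ - t

    instance
      a-nonNeg : NonNegative a
      a-nonNeg = nonNegative (ℚ.<⇒≤ 0<a)
      s-nonNeg : NonNegative s
      s-nonNeg = nonNegative (p≤q⇒0≤q-p t≤W-1)

    x′ : Weights n
    x′ = pushforward (extend A₀) x

    y : Weights n
    y B = s * x₀ B + (a * x′ B + (- (s * a)) * pointMass A₀ B)

    x-nonNeg : ∀ {A} → A ∈ₗ S G → 0ℚ ≤ x A
    x-nonNeg {A} A∈S = proj₁ x-col A (∈S⇒independent A∈S)

    sumWhere-y : ∀ q → sumWhere (S G) q y ≡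
      s * sumWhere (S G) q x₀
        + (a * sumWhere (S G) (q ∘ extend A₀) x + (- (s * a)) * (if q A₀ then 1ℚ else 0ℚ))
    sumWhere-y q = begin
        sumWhere (S G) q y
      ≡⟨ sumWhere-linear (S G) q s x₀ _ ⟩
        X₀ + sumWhere (S G) q (λ B → a * x′ B + (- (s * a)) * pointMass A₀ B)
      ≡⟨ cong (X₀ +_) (sumWhere-linear (S G) q a x′ _) ⟩
        X₀ + (a * sumWhere (S G) q x′ + sumWhere (S G) q (λ B → (- (s * a)) * pointMass A₀ B))
      ≡⟨ cong (X₀ +_) (cong₂ (λ p r → a * p + r)
           (sumWhere-pushforward (λ {A} → extend-independent {A₀} {A} indA₀) q x)
           (trans (sumWhere-*ˡ (S G) q (- (s * a)) (pointMass A₀))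
                  (cong (- (s * a) *_) (sumWhere-pointMass indA₀ q)))) ⟩
        X₀ + (a * sumWhere (S G) (q ∘ extend A₀) x + (- (s * a)) * (if q A₀ then 1ℚ else 0ℚ)) ∎
      where
      open ≡-Reasoning
      X₀ = s * sumWhere (S G) q x₀

    -- Stated with y B unfolded, so that matching on B ≟ₛ A₀ evaluates the point mass.
    y-nonNeg : ∀ B → Independent G B →
      0ℚ ≤ s * x₀ B + (a * x′ B + (- (s * a)) * (if does (B ≟ₛ A₀) then 1ℚ else 0ℚ))
    y-nonNeg B indB with B ≟ₛ A₀
    ... | yes refl = subst (0ℚ ≤_)
      (solve 3 (λ s a p → a :* p := s :* a :+ (a :* p :+ (:- (s :* a)) :* con 1ℚ)) refl s a (x′ A₀))
      (*-nonNeg (ℚ.<⇒≤ 0<a) (pushforward-nonNeg (extend A₀) x-nonNeg A₀))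
    ... | no _ = subst (0ℚ ≤_)
      (solve 4 (λ s a p q → s :* p :+ a :* q := s :* p :+ (a :* q :+ (:- (s :* a)) :* con 0ℚ))
        refl s a (x₀ B) (x′ B))
      (ℚ.+-mono-≤ {0ℚ} {_} {0ℚ} (*-nonNeg (ℚ.nonNegative⁻¹ s) (proj₁ x₀-col B indB))
                                (*-nonNeg (ℚ.<⇒≤ 0<a) (pushforward-nonNeg (extend A₀) x-nonNeg B)))

    y-coverage : ∀ v → s + a ≤ coverage y v
    y-coverage v =
      ℚ.≤-trans (bound (lookup A₀ v) refl) (ℚ.≤-reflexive (sym (sumWhere-y (λ A → lookup A v))))
      where
      C′ = sumWhere (S G) (λ A → lookup (extend A₀ A) v) x
      m = nbhdWeight x v
      raise : ∀ ι {L} → L ≤ C′ →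
        s * 1ℚ + (a * L + (- (s * a)) * ι) ≤ s * coverage x₀ v + (a * C′ + (- (s * a)) * ι)
      raise ι L≤C′ = ℚ.+-mono-≤ (ℚ.*-monoˡ-≤-nonNeg s (proj₂ x₀-col v))
                                (ℚ.+-monoˡ-≤ ((- (s * a)) * ι) (ℚ.*-monoˡ-≤-nonNeg a L≤C′))
      bound : ∀ b → lookup A₀ v ≡ b →
        s + a ≤ s * coverage x₀ v + (a * C′ + (- (s * a)) * (if b then 1ℚ else 0ℚ))
      bound true A₀v = ℚ.≤-trans
        (ℚ.≤-reflexive (solve 2 (λ s a →
          s :+ a := s :* con 1ℚ :+ (a :* (s :+ con 1ℚ) :+ (:- (s :* a)) :* con 1ℚ)) refl s a))
        (raise 1ℚ s+1≤C′)
        where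
        open ℚ.≤-Reasoning
        s+1≤C′ : s + 1ℚ ≤ C′
        s+1≤C′ = begin
          s + 1ℚ      ≡⟨ solve 2 (λ W t → W :- con 1ℚ :- t :+ con 1ℚ := W :- t) refl W t ⟩
          W - t       ≤⟨ ℚ.+-monoʳ-≤ W (ℚ.neg-antimono-≤ (nbhd≤t v (from T-≡ A₀v))) ⟩
          W - m       ≡⟨ cong (_- m) (sym (extend-+-nbhdWeight {A₀} x (from T-≡ A₀v))) ⟩
          C′ + m - m  ≡⟨ solve 2 (λ c m → c :+ m :- m := c) refl C′ m ⟩
          C′          ∎
      bound false _ = ℚ.≤-trans
        (ℚ.≤-reflexive (solve 2 (λ s a →
          s :+ a := s :* con 1ℚ :+ (a :* con 1ℚ :+ (:- (s :* a)) :* con 0ℚ)) refl s a))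
        (raise 0ℚ (ℚ.≤-trans (proj₂ x-col v) (coverage-≤-extend A₀ x-nonNeg v)))

    χ-1≤t : χ - 1ℚ ≤ t
    χ-1≤t = 0≤q-p⇒p≤q (ℚ.*-cancelˡ-≤-pos a {{positive 0<a}} (begin
        a * 0ℚ                                              ≡⟨ ℚ.*-zeroʳ a ⟩
        0ℚ                                                  ≤⟨ p≤q⇒0≤q-p χ[s+a]≤total ⟩
        totalWeight G y - χ * (s + a)                       ≡⟨ cong (_- χ * (s + a)) total-y ⟩
        s * χ + (a * W + (- (s * a)) * 1ℚ) - χ * (s + a)   ≡⟨ cancel ⟩
        a * (t - (χ - 1ℚ))                                  ∎))
      where
      open ℚ.≤-Reasoning
      χ[s+a]≤total : χ * (s + a) ≤ totalWeight G y
      χ[s+a]≤total =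
        lowerBound-scale χ-lower y-nonNeg (ℚ.+-mono-≤-< (ℚ.nonNegative⁻¹ s) 0<a) y-coverage
      total-y : totalWeight G y ≡ s * χ + (a * W + (- (s * a)) * 1ℚ)
      total-y = trans (sumWhere-y (λ _ → true))
                      (cong (λ X₀ → s * X₀ + (a * W + (- (s * a)) * 1ℚ)) x₀-total)
      cancel : s * χ + (a * W + (- (s * a)) * 1ℚ) - χ * (s + a) ≡ a * (t - (χ - 1ℚ))
      cancel = solve 4 (λ χ W t a → let s = W :- con 1ℚ :- t in
        s :* χ :+ (a :* W :+ (:- (s :* a)) :* con 1ℚ) :- χ :* (s :+ a) := a :* (t :- (χ :- con 1ℚ)))
        refl χ W t a

  neighbourhood-bound :
    ∀ {χ} → (∀ y → FractionalColoring G y → χ ≤ totalWeight G y) →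
    ∀ {x₀} → FractionalColoring G x₀ → totalWeight G x₀ ≡ χ →
    ∀ {A₀} → Independent G A₀ → 0ℚ < x₀ A₀ →
    ∀ {x} → FractionalColoring G x →
    ∀ {t} → (∀ v → T (lookup A₀ v) → nbhdWeight x v ≤ t) → χ - 1ℚ ≤ t
  neighbourhood-bound χ-lower x₀-col x₀-total indA₀ 0<a {x} x-col {t} nbhd≤t
    with ℚ.≤-total t (totalWeight G x - 1ℚ)
  ... | inj₁ t≤W-1 = Exchange.χ-1≤t χ-lower x₀-col x₀-total indA₀ 0<a x-col nbhd≤t t≤W-1
  ... | inj₂ W-1≤t = ℚ.≤-trans (ℚ.+-monoˡ-≤ (- 1ℚ) (χ-lower x x-col)) W-1≤t

  heavyIndependentSet : ∀ {x₀} → FractionalColoring G x₀ → ∀ v₀ →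
    ∃[ A₀ ] Independent G A₀ × T (lookup A₀ v₀) × 0ℚ < x₀ A₀
  heavyIndependentSet {x₀} x₀-col v₀
    with ∑-pos (S G) (λ A → if lookup A v₀ then x₀ A else 0ℚ)
                     (ℚ.<-≤-trans (ℚ.positive⁻¹ 1ℚ) (proj₂ x₀-col v₀))
  ... | A₀ , A₀∈S , 0<x₀A₀ with lookup A₀ v₀ in A₀∋v₀
  ...   | true  = A₀ , ∈S⇒independent A₀∈S , from T-≡ A₀∋v₀ , 0<x₀A₀
  ...   | false = ⊥-elim (ℚ.<-irrefl refl 0<x₀A₀)

∃-argmax-∈ : ∀ {n} (f : Fin n → ℚ) (A : Subset n) {v₀} → T (lookup A v₀) →
  ∃[ w ] T (lookup A w) × (∀ v → T (lookup A v) → f v ≤ f w)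
∃-argmax-∈ {n} f A {v₀} A∋v₀ =
  w , argmax-all f A∋v₀ (all-filter (T? ∘ lookup A) (allFinL n)) , maximal
  where
  candidates = filterᵇ (lookup A) (allFinL n)
  w = argmax f v₀ candidates
  maximal : ∀ v → T (lookup A v) → f v ≤ f w
  maximal v A∋v = All.lookup (f[xs]≤f[argmax] v₀ candidates)
    (∈-filter⁺ (T? ∘ lookup A) (∈-allFin v) A∋v)

T-lookup⇒∈ : ∀ {n} {A : Subset n} {v} → T (lookup A v) → v ∈ A
T-lookup⇒∈ {A = A} {v} A∋v = lookup⇒[]= v A (to T-≡ A∋v)

theorem2 : ∀ {n : ℕ} (G : Graph n) (v₀ : Fin n) (χ* : ℚ) →
    IsFracChromaticNumber G χ* →
    Σ (Subset n) λ A₀ → Independent G A₀ × v₀ ∈ A₀ ×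
      (∀ (x : Weights n) → FractionalColoring G x →
        Σ (Fin n) λ v → v ∈ A₀ × (χ* - 1ℚ ≤ sumWhere (S G) (meetsNbhdᵇ G v) x))
theorem2 G v₀ χ* (isFCN x₀ x₀-col x₀-total χ*-lower)
  with heavyIndependentSet G x₀-col v₀
... | A₀ , indA₀ , A₀∋v₀ , 0<x₀A₀ = A₀ , indA₀ , T-lookup⇒∈ A₀∋v₀ , nbhdBound
  where
  nbhdBound : ∀ x → FractionalColoring G x →
    Σ (Fin _) λ v → v ∈ A₀ × (χ* - 1ℚ ≤ sumWhere (S G) (meetsNbhdᵇ G v) x)
  nbhdBound x x-col with ∃-argmax-∈ (nbhdWeight G x) A₀ A₀∋v₀
  ... | w , A₀∋w , w-max = w , T-lookup⇒∈ A₀∋w ,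
    neighbourhood-bound G χ*-lower x₀-col x₀-total indA₀ 0<x₀A₀ x-col w-max
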